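{- Let $\mathbf{H}(@)$ be the minimal normal hybrid logic with the satisfaction operator (axioms: propositional tautologies, $K$, $\Diamond p\leftrightarrow\neg\Box\neg p$, $@_{\mathbf{j}}(p\to q)\to(@_{\mathbf{j}}p\to @_{\mathbf{j}}q)$, $\neg@_{\mathbf{j}}p\leftrightarrow @_{\mathbf{j}}\neg p$, $\mathbf{j}\wedge p\to @_{\mathbf{j}}p$, $@_{\mathbf{j}}\mathbf{j}$, $@_{\mathbf{i}}@_{\mathbf{j}}p\to @_{\mathbf{j}}p$, $\Diamond @_{\mathbf{j}}p\to @_{\mathbf{j}}p$; rules: modus ponens, sorted substitution, necessitation for $\Box$ and for $@_{\mathbf{j}}$), and let $\mathbf{H}^{+}(@)$ be obtained by additionally closing under ($\mathit{Name}_@$): if $\vdash @_{\mathbf{j}}\phi$ then $\vdash\phi$ for $\mathbf{j}$ not occurring in $\phi$, and ($\mathit{BG}_@$): if $\vdash @_{\mathbf{i}}\Diamond\mathbf{j}\wedge @_{\mathbf{j}}\phi\to\psi$ then $\vdash @_{\mathbf{i}}\Diamond\phi\to\psi$ for $\mathbf{j}\neq\mathbf{i}$ not occurring in $\phi,\psi$. Then $\mathbf{H}(@)\oplus\{@_{\mathbf{j}}\Box\bot\}\not\vdash\Box\bot$, while $\mathbf{H}^{+}(@)\oplus\{@_{\mathbf{j}}\Box\bot\}\vdash\Box\bot$.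
   Context: The witness is the descriptive two-sorted general frame $\mathfrak{g}=(W,R,A,B)$ with $W=\{u,v\}$, $R=\{(u,u)\}$, $A=\mathcal{P}(W)$, $B=\{v\}$ (nominals denote singletons of points in $B$), which validates $@_{\mathbf{j}}\Box\bot$ and satisfies $\Diamond\top$ at $u$, together with soundness of $\mathbf{H}(@)\oplus\Sigma$ with respect to its descriptive two-sorted general frames. -}

module Defs where

open import Data.Nat using (ℕ)
open import Data.Bool using (Bool; true; false; _∧_; not)
open import Data.Product using (_×_)
open import Data.Empty using (⊥)
open import Data.Unit using (⊤)
open import Relation.Binary.PropositionalEquality using (_≡_; _≢_)

infixr 5 _⇒_
data Form : Set where
  var  : ℕ → Form
  nom  : ℕ → Form
  fls  : Form
  _⇒_  : Form → Form → Form
  □    : Form → Form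
  ◇    : Form → Form
  at   : ℕ → Form → Form

¬' : Form → Form
¬' φ = φ ⇒ fls

tru : Form
tru = ¬' fls

_∧'_ : Form → Form → Form
φ ∧' ψ = ¬' (φ ⇒ ¬' ψ)

_⇔_ : Form → Form → Form
φ ⇔ ψ = (φ ⇒ ψ) ∧' (ψ ⇒ φ)

-- Propositional tautologies (instances): evaluate Boolean structure,
-- treating every non-Boolean subformula as an atom with value given by v.
evalPL : (Form → Bool) → Form → Bool
evalPL v fls = false
evalPL v (φ ⇒ ψ) = not (evalPL v φ) Data.Bool.∨ evalPL v ψ
evalPL v φ = v φ

Tautology : Form → Set
Tautology φ = (v : Form → Bool) → evalPL v φ ≡ true

subst : (ℕ → Form) → (ℕ → ℕ) → Form → Form
subst σ τ (var n) = σ n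
subst σ τ (nom n) = nom (τ n)
subst σ τ fls = fls
subst σ τ (φ ⇒ ψ) = subst σ τ φ ⇒ subst σ τ ψ
subst σ τ (□ φ) = □ (subst σ τ φ)
subst σ τ (◇ φ) = ◇ (subst σ τ φ)
subst σ τ (at n φ) = at (τ n) (subst σ τ φ)

NotOcc : ℕ → Form → Set
NotOcc j (var n) = ⊤
NotOcc j (nom n) = j ≢ n
NotOcc j fls = ⊤
NotOcc j (φ ⇒ ψ) = NotOcc j φ × NotOcc j ψ
NotOcc j (□ φ) = NotOcc j φ
NotOcc j (◇ φ) = NotOcc j φ
NotOcc j (at n φ) = (j ≢ n) × NotOcc j φ

p q : Form
p = var 0
q = var 1

jₙ iₙ : ℕ
jₙ = 0
iₙ = 1

data HAxiom : Form → Set where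
  K     : HAxiom (□ (p ⇒ q) ⇒ (□ p ⇒ □ q))
  Dual  : HAxiom (◇ p ⇔ ¬' (□ (¬' p)))
  Kat   : HAxiom (at jₙ (p ⇒ q) ⇒ (at jₙ p ⇒ at jₙ q))
  SelfD : HAxiom (¬' (at jₙ p) ⇔ at jₙ (¬' p))
  Intro : HAxiom ((nom jₙ ∧' p) ⇒ at jₙ p)
  Ref   : HAxiom (at jₙ (nom jₙ))
  Agree : HAxiom (at iₙ (at jₙ p) ⇒ at jₙ p)
  Back  : HAxiom (◇ (at jₙ p) ⇒ at jₙ p)

-- Derivability in H(@) ⊕ Σ (plus = false) or H⁺(@) ⊕ Σ (plus = true),
-- where Σ is the set of extra axioms.
data Deriv (plus : Bool) (Σ : Form → Set) : Form → Set where
  taut  : ∀ {φ} → Tautology φ → Deriv plus Σ φ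
  ax    : ∀ {φ} → HAxiom φ → Deriv plus Σ φ
  extra : ∀ {φ} → Σ φ → Deriv plus Σ φ
  mp    : ∀ {φ ψ} → Deriv plus Σ (φ ⇒ ψ) → Deriv plus Σ φ → Deriv plus Σ ψ
  sub   : ∀ {φ} (σ : ℕ → Form) (τ : ℕ → ℕ) → Deriv plus Σ φ → Deriv plus Σ (subst σ τ φ)
  nec□  : ∀ {φ} → Deriv plus Σ φ → Deriv plus Σ (□ φ)
  necAt : ∀ {φ} (j : ℕ) → Deriv plus Σ φ → Deriv plus Σ (at j φ)
  nameAt : ∀ {φ} (j : ℕ) → plus ≡ true → NotOcc j φ →
          Deriv plus Σ (at j φ) → Deriv plus Σ φ
  bgAt  : ∀ {φ ψ} (i j : ℕ) → plus ≡ true → j ≢ i → NotOcc j φ → NotOcc j ψ →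
          Deriv plus Σ ((at i (◇ (nom j)) ∧' at j φ) ⇒ ψ) →
          Deriv plus Σ (at i (◇ φ) ⇒ ψ)

AtBoxBot : ℕ → Form → Set
AtBoxBot j φ = φ ≡ at j (□ fls)

HAt⊕ : (Form → Set) → Form → Set
HAt⊕ Σ = Deriv false Σ

H⁺At⊕ : (Form → Set) → Form → Set
H⁺At⊕ Σ = Deriv true Σ

-- Every theorem of H(@) ⊕ {@_j □⊥} is valid on the two-sorted frame with points
-- u, v, accessibility u R u only, and v as the only nameable point: there
-- @_j □⊥ holds, since j must name the dead end v, while □⊥ fails at the
-- reflexive point u. In H⁺(@) the rule Name_@ turns the axiom @_j □⊥ into □⊥
-- directly, because j does not occur in □⊥.
module Submission where

open import Defs
open import Data.Nat using (ℕ)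
open import Data.Bool using (Bool; true; false; not; _∧_; _∨_)
open import Data.Bool.Properties using (∧-conicalˡ; ∧-conicalʳ; ∨-inverseˡ; ∨-identityʳ)
open import Data.Bool.ListAction using (all; any; and; or)
open import Data.List using (List; []; _∷_)
open import Data.List.Properties using (map-cong)
open import Data.Product using (_×_; _,_)
open import Data.Unit using (⊤; tt)
open import Function using (_∘_)
open import Relation.Binary.Definitions using (DecidableEquality)
open import Relation.Binary.PropositionalEquality using (_≡_; refl; sym; trans; cong; cong₂; module ≡-Reasoning)
import Relation.Binary.PropositionalEquality as ≡
open import Relation.Nullary using (¬_; does; yes; no)
open import Relation.Nullary.Decidable using (dec-true)

⇒ᵇ-intro : ∀ {a b} → (a ≡ true → b ≡ true) → not a ∨ b ≡ true
⇒ᵇ-intro {false} _ = refl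
⇒ᵇ-intro {true} a⇒b = a⇒b refl

⇒ᵇ-elim : ∀ {a b} → not a ∨ b ≡ true → a ≡ true → b ≡ true
⇒ᵇ-elim a⇒b refl = a⇒b

all-true : ∀ {A : Set} {f : A → Bool} (xs : List A) → (∀ x → f x ≡ true) → all f xs ≡ true
all-true [] _ = refl
all-true (x ∷ xs) f≡true = cong₂ _∧_ (f≡true x) (all-true xs f≡true)

all-zipWith : ∀ {A : Set} {f g h : A → Bool} (xs : List A) →
              (∀ x → f x ≡ true → g x ≡ true → h x ≡ true) →
              all f xs ≡ true → all g xs ≡ true → all h xs ≡ true
all-zipWith [] _ _ _ = refl
all-zipWith {f = f} {g} (x ∷ xs) fg⇒h fs gs =
  cong₂ _∧_ (fg⇒h x (∧-conicalˡ (f x) _ fs) (∧-conicalˡ (g x) _ gs))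
            (all-zipWith xs fg⇒h (∧-conicalʳ (f x) _ fs) (∧-conicalʳ (g x) _ gs))

any≡not-all-not : ∀ {A : Set} (f : A → Bool) (xs : List A) → any f xs ≡ not (all (not ∘ f) xs)
any≡not-all-not f [] = refl
any≡not-all-not f (x ∷ xs) with f x
... | true = refl
... | false = any≡not-all-not f xs

any-const : ∀ {A : Set} {b : Bool} (xs : List A) → any (λ _ → b) xs ≡ true → b ≡ true
any-const {b = true} _ _ = refl
any-const {b = false} (_ ∷ xs) = any-const xs

-- Image-finite two-sorted Kripke frames whose admissible sets are all subsets of
-- W; nominals may only denote points in the image of B.
record Frame : Set₁ where
  field
    W : Set
    _≟_ : DecidableEquality W
    successors : W → List W
    B : Set
    point : B → W

module Semantics (F : Frame) where
  open Frame F

  Valuation : Set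
  Valuation = ℕ → W → Bool

  Assignment : Set
  Assignment = ℕ → B

  sat : Valuation → Assignment → W → Form → Bool
  sat V g w (var n) = V n w
  sat V g w (nom n) = does (w ≟ point (g n))
  sat V g w fls = false
  sat V g w (φ ⇒ ψ) = not (sat V g w φ) ∨ sat V g w ψ
  sat V g w (□ φ) = all (λ w′ → sat V g w′ φ) (successors w)
  sat V g w (◇ φ) = any (λ w′ → sat V g w′ φ) (successors w)
  sat V g w (at n φ) = sat V g (point (g n)) φ

  Valid : Form → Set
  Valid φ = ∀ V g w → sat V g w φ ≡ true

  evalPL-sat : ∀ V g w φ → evalPL (sat V g w) φ ≡ sat V g w φ
  evalPL-sat V g w (var _) = refl
  evalPL-sat V g w (nom _) = refl
  evalPL-sat V g w fls = refl
  evalPL-sat V g w (φ ⇒ ψ) = cong₂ (λ a b → not a ∨ b) (evalPL-sat V g w φ) (evalPL-sat V g w ψ)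
  evalPL-sat V g w (□ _) = refl
  evalPL-sat V g w (◇ _) = refl
  evalPL-sat V g w (at _ _) = refl

  sat-subst : ∀ V g σ τ w φ →
              sat V g w (subst σ τ φ) ≡ sat (λ n w′ → sat V g w′ (σ n)) (g ∘ τ) w φ
  sat-subst V g σ τ w (var _) = refl
  sat-subst V g σ τ w (nom _) = refl
  sat-subst V g σ τ w fls = refl
  sat-subst V g σ τ w (φ ⇒ ψ) =
    cong₂ (λ a b → not a ∨ b) (sat-subst V g σ τ w φ) (sat-subst V g σ τ w ψ)
  sat-subst V g σ τ w (□ φ) = cong and (map-cong (λ w′ → sat-subst V g σ τ w′ φ) (successors w))
  sat-subst V g σ τ w (◇ φ) = cong or (map-cong (λ w′ → sat-subst V g σ τ w′ φ) (successors w))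
  sat-subst V g σ τ w (at n φ) = sat-subst V g σ τ (point (g (τ n))) φ

  sat-∧-elim : ∀ V g w φ ψ → sat V g w (φ ∧' ψ) ≡ true → sat V g w φ ≡ true × sat V g w ψ ≡ true
  sat-∧-elim V g w φ ψ h with sat V g w φ | sat V g w ψ
  ... | true | true = refl , refl

  sat-⇔-intro : ∀ V g w φ ψ → sat V g w φ ≡ sat V g w ψ → sat V g w (φ ⇔ ψ) ≡ true
  sat-⇔-intro V g w φ ψ eq rewrite eq with sat V g w ψ
  ... | true = refl
  ... | false = refl

  sat-nom : ∀ V g w n → sat V g w (nom n) ≡ true → w ≡ point (g n)
  sat-nom V g w n h with w ≟ point (g n)
  ... | yes w≡gn = w≡gn

  axiom-valid : ∀ {φ} → HAxiom φ → Valid φ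
  axiom-valid K V g w =
    ⇒ᵇ-intro λ □[p⇒q] → ⇒ᵇ-intro λ □p → all-zipWith (successors w) (λ _ → ⇒ᵇ-elim) □[p⇒q] □p
  axiom-valid Dual V g w = sat-⇔-intro V g w (◇ p) (¬' (□ (¬' p))) (begin
    any (V 0) (successors w)                                  ≡⟨ any≡not-all-not (V 0) (successors w) ⟩
    not (all (not ∘ V 0) (successors w))                      ≡⟨ cong not (cong and (map-cong (λ w′ → sym (∨-identityʳ (not (V 0 w′)))) (successors w))) ⟩
    not (all (λ w′ → not (V 0 w′) ∨ false) (successors w))   ≡⟨ sym (∨-identityʳ _) ⟩
    not (all (λ w′ → not (V 0 w′) ∨ false) (successors w)) ∨ false ∎)
    where open ≡-Reasoning
  axiom-valid Kat V g w = ∨-inverseˡ (sat V g w (at jₙ (p ⇒ q)))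
  axiom-valid SelfD V g w = sat-⇔-intro V g w (¬' (at jₙ p)) (at jₙ (¬' p)) refl
  axiom-valid Intro V g w = ⇒ᵇ-intro λ j∧p →
    let (wj , wp) = sat-∧-elim V g w (nom jₙ) p j∧p
    in ≡.subst (λ x → sat V g x p ≡ true) (sat-nom V g w jₙ wj) wp
  axiom-valid Ref V g w = dec-true (point (g jₙ) ≟ point (g jₙ)) refl
  axiom-valid Agree V g w = ∨-inverseˡ (sat V g w (at jₙ p))
  axiom-valid Back V g w = ⇒ᵇ-intro (any-const (successors w))

  soundness : ∀ {Σ} → (∀ {φ} → Σ φ → Valid φ) → ∀ {φ} → HAt⊕ Σ φ → Valid φ
  soundness Σ-valid (taut {φ} t) V g w = trans (sym (evalPL-sat V g w φ)) (t (sat V g w))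
  soundness Σ-valid (ax a) = axiom-valid a
  soundness Σ-valid (extra s) = Σ-valid s
  soundness Σ-valid (mp d e) V g w = ⇒ᵇ-elim (soundness Σ-valid d V g w) (soundness Σ-valid e V g w)
  soundness Σ-valid (sub {φ} σ τ d) V g w = trans (sat-subst V g σ τ w φ) (soundness Σ-valid d _ _ w)
  soundness Σ-valid (nec□ d) V g w = all-true (successors w) (soundness Σ-valid d V g)
  soundness Σ-valid (necAt j d) V g w = soundness Σ-valid d V g _

data World : Set where
  u v : World

_≟ʷ_ : DecidableEquality World
u ≟ʷ u = yes refl
u ≟ʷ v = no λ ()
v ≟ʷ u = no λ ()
v ≟ʷ v = yes refl

loopAndDeadEnd : Frame
loopAndDeadEnd = record
  { W = World
  ; _≟_ = _≟ʷ_
  ; successors = λ { u → u ∷ [] ; v → [] }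
  ; B = ⊤
  ; point = λ _ → v
  }

open Semantics loopAndDeadEnd

atBoxBot-valid : ∀ j {φ} → AtBoxBot j φ → Valid φ
atBoxBot-valid j refl V g w = refl

boxBot-invalid : ¬ Valid (□ fls)
boxBot-invalid valid with valid (λ _ _ → false) (λ _ → tt) u
... | ()

mainTheorem2 : (j : ℕ) → (¬ HAt⊕ (AtBoxBot j) (□ fls)) × H⁺At⊕ (AtBoxBot j) (□ fls)
mainTheorem2 j = boxBot-invalid ∘ soundness (atBoxBot-valid j) , nameAt j refl tt (extra refl)
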